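{- Let $W$ be a finite Coxeter group with simple reflections $S$, $c$ a Coxeter element of $W$ and $(r_1,\dots,r_n)$ a minimal factorization of $c$. For $1\le i\le n$ put $r_i'=(r_1\cdots r_{i-1})\,r_i\,(r_1\cdots r_{i-1})^{ -1}$, so that $(r_1',\dots,r_n')$ is a minimal factorization of $c^{ -1}$. Then for each $i$, $r_i$ is one-way in $(r_1,\dots,r_n)$ if and only if $r_i'$ is one-way in $(r_1',\dots,r_n')$. In particular, $(r_1,\dots,r_n)\mapsto(r_1',\dots,r_n')$ gives a bijection between signed minimal factorizations of $c$ and signed minimal factorizations of $c^{ -1}$ preserving one-wayness.
   Context: $l(w)$ denotes the length of $w$ with respect to $S$. A minimal factorization of an element $w$ is a sequence of reflections $(t_1,\dots,t_n)$ with $w=t_1\cdots t_n$ and $n$ minimal. In a minimal factorization $(t_1,\dots,t_n)$, $t_i$ is one-way if $l(t_1\cdots t_{i-1})<l(t_1\cdots t_i)$, and two-way otherwise. A signed minimal factorization is a minimal factorization $(t_1,\dots,t_n)$ together with signs $(\epsilon_1,\dots,\epsilon_n)$, where $\epsilon_i\in\{1,-1\}$ if $t_i$ is one-way and $\epsilon_i=1$ if $t_i$ is two-way. -}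

module Defs where

open import Level using (Level; _⊔_)
open import Data.Nat using (ℕ; zero; suc; _≤_; _<_)
open import Data.Fin using (Fin; toℕ)
open import Data.List using (List; []; _∷_; allFin; length)
open import Data.List.Relation.Binary.Permutation.Propositional using (_↭_)
open import Data.List.Relation.Unary.All using (All)
open import Data.Vec using (Vec; []; _∷_; lookup)
open import Data.Product using (Σ; ∃; ∃-syntax; _×_; _,_)
open import Relation.Binary.PropositionalEquality as ≡ using (_≡_)
open import Relation.Nullary using (¬_)
open import Function.Bundles using (Inverse)
open import Algebra.Bundles using (Group)
open import Algebra.Morphism.Structures using (module GroupMorphisms)

pow : ∀ {c ℓ} (G : Group c ℓ) → Group.Carrier G → ℕ → Group.Carrier G
pow G x zero = Group.ε G
pow G x (suc m) = Group._∙_ G x (pow G x m)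

-- Everything is relative to a group G (with setoid equality ≈) and a
-- family of n distinguished elements gen : Fin n → G (the candidate set S).
module Coxeter {c ℓ : Level} (G : Group c ℓ) {n : ℕ} (gen : Fin n → Group.Carrier G) where
  open Group G

  eval : List (Fin n) → Carrier
  eval [] = ε
  eval (s ∷ w) = gen s ∙ eval w

  -- (G, S) is a Coxeter system: S consists of distinct involutions generating G,
  -- and G has the universal property of the group presented by the Coxeter
  -- relations (s t)^{m(s,t)} = 1 (m(s,t) the order of st in G).
  record IsCoxeterSystem : Set (Level.suc (c ⊔ ℓ)) where
    field
      gen-injective : ∀ s t → gen s ≈ gen t → s ≡ t
      gen-involution : ∀ s → gen s ∙ gen s ≈ ε
      generates : ∀ (w : Carrier) → ∃[ ws ] eval ws ≈ w
      universal : ∀ (H : Group c ℓ) (f : Fin n → Group.Carrier H) →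
        (∀ s t m → pow G (gen s ∙ gen t) m ≈ ε →
           Group._≈_ H (pow H (Group._∙_ H (f s) (f t)) m) (Group.ε H)) →
        Σ (Carrier → Group.Carrier H) λ φ →
          GroupMorphisms.IsGroupHomomorphism (Group.rawGroup G) (Group.rawGroup H) φ ×
          (∀ s → Group._≈_ H (φ (gen s)) (f s))

  IsFinite : Set (c ⊔ ℓ)
  IsFinite = Σ ℕ λ N → Inverse setoid (≡.setoid (Fin N))

  IsFiniteCoxeterSystem : Set (Level.suc (c ⊔ ℓ))
  IsFiniteCoxeterSystem = IsCoxeterSystem × IsFinite

  IsLength : Carrier → ℕ → Set ℓ
  IsLength w k = (∃[ ws ] (length ws ≡ k × eval ws ≈ w))
               × (∀ ws → eval ws ≈ w → k ≤ length ws)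

  IsReflection : Carrier → Set (c ⊔ ℓ)
  IsReflection t = ∃[ g ] ∃[ s ] (t ≈ (g ∙ gen s) ∙ g ⁻¹)

  IsCoxeterElement : Carrier → Set ℓ
  IsCoxeterElement x = ∃[ ws ] (ws ↭ allFin n × x ≈ eval ws)

  prod : ∀ {k} → Vec Carrier k → Carrier
  prod [] = ε
  prod (x ∷ xs) = x ∙ prod xs

  -- prefix product t₁ ⋯ t_i (i truncated at k)
  prefix : ∀ {k} → Vec Carrier k → ℕ → Carrier
  prefix xs zero = ε
  prefix [] (suc i) = ε
  prefix (x ∷ xs) (suc i) = x ∙ prefix xs i

  data AllV (P : Carrier → Set (c ⊔ ℓ)) : ∀ {k} → Vec Carrier k → Set (c ⊔ ℓ) where
    [] : AllV P []
    _∷_ : ∀ {k x} {xs : Vec Carrier k} → P x → AllV P xs → AllV P (x ∷ xs)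

  IsFactorization : Carrier → ∀ {k} → Vec Carrier k → Set (c ⊔ ℓ)
  IsFactorization w ts = AllV IsReflection ts × prod ts ≈ w

  IsMinFactorization : Carrier → ∀ {k} → Vec Carrier k → Set (c ⊔ ℓ)
  IsMinFactorization w {k} ts =
    IsFactorization w ts × (∀ m (qs : Vec Carrier m) → IsFactorization w qs → k ≤ m)

  -- t_i (0-based index i) is one-way: l(t₁⋯t_{i-1}) < l(t₁⋯t_i)
  OneWay : ∀ {k} → Vec Carrier k → Fin k → Set ℓ
  OneWay ts i = ∃[ a ] ∃[ b ] (IsLength (prefix ts (toℕ i)) a
                               × IsLength (prefix ts (suc (toℕ i))) b × a < b)

  -- (r₁,…,r_k) ↦ (r₁',…,r_k'),  r_i' = p r_i p⁻¹ with p = r₁⋯r_{i-1}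
  conjFactAux : ∀ {k} → Carrier → Vec Carrier k → Vec Carrier k
  conjFactAux p [] = []
  conjFactAux p (r ∷ rs) = ((p ∙ r) ∙ p ⁻¹) ∷ conjFactAux (p ∙ r) rs

  conjFact : ∀ {k} → Vec Carrier k → Vec Carrier k
  conjFact = conjFactAux ε

  data _≋_ : ∀ {k} → Vec Carrier k → Vec Carrier k → Set (c ⊔ ℓ) where
    [] : [] ≋ []
    _∷_ : ∀ {k x y} {xs ys : Vec Carrier k} → x ≈ y → xs ≋ ys → (x ∷ xs) ≋ (y ∷ ys)

{-# OPTIONS --safe #-}
-- Since every r_i is an involution, r₁'⋯r_i' = (r₁⋯r_i)⁻¹, and reversing words shows
-- l(w⁻¹) = l(w); hence the lengths of the prefixes of the two factorizations agree,
-- which is the statement on one-wayness.  Conjugating by the running prefix is undone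
-- by conjugating by the running prefix of the new factorization, which gives the
-- bijection.
module Submission where

open import Defs
open import Level using (Level)
open import Data.Nat using (ℕ; zero; suc; _≤_)
open import Data.Fin using (Fin; toℕ)
open import Data.List using ([]; _∷_; _ʳ++_; reverse)
open import Data.List.Properties using (length-reverse)
open import Data.Vec using (Vec; []; _∷_)
open import Data.Product using (∃-syntax; _×_; _,_; proj₁)
open import Function.Base using (_∘_)
open import Function.Bundles using (_⇔_; mk⇔; module Equivalence)
open import Relation.Binary.PropositionalEquality as ≡ using (_≡_)
open import Algebra.Bundles using (Group)
import Algebra.Properties.Group as GroupProperties
import Algebra.Solver.Monoid as MonoidSolver
import Relation.Binary.Reasoning.Setoid as SetoidReasoning

module Conjugation {c ℓ : Level} (G : Group c ℓ) where
  open Group G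
  open GroupProperties G
  open SetoidReasoning setoid

  conj : Carrier → Carrier → Carrier
  conj p x = (p ∙ x) ∙ p ⁻¹

  conj-cong : ∀ {p q x y} → p ≈ q → x ≈ y → conj p x ≈ conj q y
  conj-cong p≈q x≈y = ∙-cong (∙-cong p≈q x≈y) (⁻¹-cong p≈q)

  conj-∙ʳ : ∀ p x → conj p x ∙ p ≈ p ∙ x
  conj-∙ʳ p x = begin
    ((p ∙ x) ∙ p ⁻¹) ∙ p ≈⟨ assoc _ _ _ ⟩
    (p ∙ x) ∙ (p ⁻¹ ∙ p) ≈⟨ ∙-congˡ (inverseˡ p) ⟩
    (p ∙ x) ∙ ε          ≈⟨ identityʳ _ ⟩
    p ∙ x                ∎

  conj-homo : ∀ p x y → conj p (x ∙ y) ≈ conj p x ∙ conj p y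
  conj-homo p x y = sym (begin
    conj p x ∙ ((p ∙ y) ∙ p ⁻¹) ≈⟨ sym (assoc _ _ _) ⟩
    (conj p x ∙ (p ∙ y)) ∙ p ⁻¹ ≈⟨ ∙-congʳ (sym (assoc _ _ _)) ⟩
    ((conj p x ∙ p) ∙ y) ∙ p ⁻¹ ≈⟨ ∙-congʳ (∙-congʳ (conj-∙ʳ p x)) ⟩
    ((p ∙ x) ∙ y) ∙ p ⁻¹        ≈⟨ ∙-congʳ (assoc _ _ _) ⟩
    (p ∙ (x ∙ y)) ∙ p ⁻¹        ∎)

  conj-ε : ∀ p → conj p ε ≈ ε
  conj-ε p = trans (∙-congʳ (identityʳ p)) (inverseʳ p)

  conj-identityˡ : ∀ x → conj ε x ≈ x
  conj-identityˡ x = trans (∙-cong (identityˡ x) ε⁻¹≈ε) (identityʳ x)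

  conj-conj : ∀ p g x → conj p (conj g x) ≈ conj (p ∙ g) x
  conj-conj p g x = begin
    (p ∙ ((g ∙ x) ∙ g ⁻¹)) ∙ p ⁻¹
      ≈⟨ solve 5 (λ p g x g⁻¹ p⁻¹ → (p ⊕ ((g ⊕ x) ⊕ g⁻¹)) ⊕ p⁻¹ ⊜ ((p ⊕ g) ⊕ x) ⊕ (g⁻¹ ⊕ p⁻¹))
               refl p g x (g ⁻¹) (p ⁻¹) ⟩
    ((p ∙ g) ∙ x) ∙ (g ⁻¹ ∙ p ⁻¹) ≈⟨ ∙-congˡ (sym (⁻¹-anti-homo-∙ p g)) ⟩
    ((p ∙ g) ∙ x) ∙ (p ∙ g) ⁻¹    ∎
    where open MonoidSolver monoid using (solve; _⊜_; _⊕_)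

  conj-injective : ∀ p {x y} → conj p x ≈ conj p y → x ≈ y
  conj-injective p {x} {y} e = ∙-cancelˡ p x y (begin
    p ∙ x        ≈⟨ sym (conj-∙ʳ p x) ⟩
    conj p x ∙ p ≈⟨ ∙-congʳ e ⟩
    conj p y ∙ p ≈⟨ conj-∙ʳ p y ⟩
    p ∙ y        ∎)

  conj-involution-∙ : ∀ p {r} → r ∙ r ≈ ε → conj p r ∙ (p ∙ r) ≈ p
  conj-involution-∙ p {r} r²≈ε = begin
    conj p r ∙ (p ∙ r) ≈⟨ sym (assoc _ _ _) ⟩
    (conj p r ∙ p) ∙ r ≈⟨ ∙-congʳ (conj-∙ʳ p r) ⟩
    (p ∙ r) ∙ r        ≈⟨ assoc _ _ _ ⟩
    p ∙ (r ∙ r)        ≈⟨ ∙-congˡ r²≈ε ⟩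
    p ∙ ε              ≈⟨ identityʳ p ⟩
    p                  ∎

module Factorizations {c ℓ : Level} (G : Group c ℓ) {n : ℕ} (gen : Fin n → Group.Carrier G)
  (gen-involutive : ∀ s → Group._≈_ G (Group._∙_ G (gen s) (gen s)) (Group.ε G)) where
  open Group G
  open GroupProperties G
  open Conjugation G
  open Coxeter G gen
  open SetoidReasoning setoid

  reflection-involutive : ∀ {t} → IsReflection t → t ∙ t ≈ ε
  reflection-involutive {t} (g , s , t≈) = begin
    t ∙ t                           ≈⟨ ∙-cong t≈ t≈ ⟩
    conj g (gen s) ∙ conj g (gen s) ≈⟨ sym (conj-homo g _ _) ⟩
    conj g (gen s ∙ gen s)          ≈⟨ conj-cong refl (gen-involutive s) ⟩
    conj g ε                        ≈⟨ conj-ε g ⟩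
    ε                               ∎

  reflection-conj : ∀ p {t} → IsReflection t → IsReflection (conj p t)
  reflection-conj p (g , s , t≈) = p ∙ g , s , trans (conj-cong refl t≈) (conj-conj p g (gen s))

  conjFactAux-reflections : ∀ {k} p {rs : Vec Carrier k} →
    AllV IsReflection rs → AllV IsReflection (conjFactAux p rs)
  conjFactAux-reflections p []       = []
  conjFactAux-reflections p (r ∷ rs) = reflection-conj p r ∷ conjFactAux-reflections _ rs

  ε≈p∙[p∙ε]⁻¹ : ∀ p → ε ≈ p ∙ (p ∙ ε) ⁻¹
  ε≈p∙[p∙ε]⁻¹ p = sym (trans (∙-congˡ (⁻¹-cong (identityʳ p))) (inverseʳ p))

  prefix-conjFactAux : ∀ {k} p {rs : Vec Carrier k} → AllV IsReflection rs → ∀ j →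
    prefix (conjFactAux p rs) j ≈ p ∙ (p ∙ prefix rs j) ⁻¹
  prefix-conjFactAux p {[]}     []       zero    = ε≈p∙[p∙ε]⁻¹ p
  prefix-conjFactAux p {[]}     []       (suc j) = ε≈p∙[p∙ε]⁻¹ p
  prefix-conjFactAux p {_ ∷ _}  (_ ∷ _)  zero    = ε≈p∙[p∙ε]⁻¹ p
  prefix-conjFactAux p {r ∷ rs} (t ∷ ts) (suc j) = begin
    conj p r ∙ prefix (conjFactAux (p ∙ r) rs) j
      ≈⟨ ∙-congˡ (prefix-conjFactAux (p ∙ r) ts j) ⟩
    conj p r ∙ ((p ∙ r) ∙ ((p ∙ r) ∙ prefix rs j) ⁻¹)
      ≈⟨ sym (assoc _ _ _) ⟩
    (conj p r ∙ (p ∙ r)) ∙ ((p ∙ r) ∙ prefix rs j) ⁻¹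
      ≈⟨ ∙-cong (conj-involution-∙ p (reflection-involutive t)) (⁻¹-cong (assoc p r _)) ⟩
    p ∙ (p ∙ (r ∙ prefix rs j)) ⁻¹ ∎

  prefix-conjFact : ∀ {k} {rs : Vec Carrier k} → AllV IsReflection rs → ∀ j →
    prefix (conjFact rs) j ≈ prefix rs j ⁻¹
  prefix-conjFact ts j = trans (prefix-conjFactAux ε ts j) (trans (identityˡ _) (⁻¹-cong (identityˡ _)))

  prefix-full : ∀ {k} (xs : Vec Carrier k) → prefix xs k ≡ prod xs
  prefix-full []       = ≡.refl
  prefix-full (x ∷ xs) = ≡.cong (x ∙_) (prefix-full xs)

  prod-conjFact : ∀ {k} {rs : Vec Carrier k} → AllV IsReflection rs → prod (conjFact rs) ≈ prod rs ⁻¹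
  prod-conjFact {k} {rs} ts =
    ≡.subst₂ (λ a b → a ≈ b ⁻¹) (prefix-full (conjFact rs)) (prefix-full rs) (prefix-conjFact ts k)

  conjFactAux-involutive : ∀ {k} p q {rs : Vec Carrier k} → AllV IsReflection rs → q ≈ p ⁻¹ →
    conjFactAux q (conjFactAux p rs) ≋ rs
  conjFactAux-involutive p q []                 q≈p⁻¹ = []
  conjFactAux-involutive p q {r ∷ rs} (t ∷ ts) q≈p⁻¹ =
    entry ∷ conjFactAux-involutive (p ∙ r) (q ∙ conj p r) ts next
    where
    entry : conj q (conj p r) ≈ r
    entry = begin
      conj q (conj p r) ≈⟨ conj-conj q p r ⟩
      conj (q ∙ p) r    ≈⟨ conj-cong (trans (∙-congʳ q≈p⁻¹) (inverseˡ p)) refl ⟩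
      conj ε r          ≈⟨ conj-identityˡ r ⟩
      r                 ∎
    next : q ∙ conj p r ≈ (p ∙ r) ⁻¹
    next = inverseˡ-unique _ _ (begin
      (q ∙ conj p r) ∙ (p ∙ r) ≈⟨ assoc _ _ _ ⟩
      q ∙ (conj p r ∙ (p ∙ r)) ≈⟨ ∙-cong q≈p⁻¹ (conj-involution-∙ p (reflection-involutive t)) ⟩
      p ⁻¹ ∙ p                 ≈⟨ inverseˡ p ⟩
      ε                        ∎)

  conjFactAux-injective : ∀ {k} {p q} {rs qs : Vec Carrier k} → p ≈ q →
    conjFactAux p rs ≋ conjFactAux q qs → rs ≋ qs
  conjFactAux-injective {rs = []}     {[]}     p≈q []         = []
  conjFactAux-injective {rs = r ∷ rs} {s ∷ qs} p≈q (e ∷ es) =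
    r≈s ∷ conjFactAux-injective (∙-cong p≈q r≈s) es
    where
    r≈s : r ≈ s
    r≈s = conj-injective _ (trans e (conj-cong (sym p≈q) refl))

  IsFactorization-resp : ∀ {w w' k} {rs : Vec Carrier k} →
    w ≈ w' → IsFactorization w rs → IsFactorization w' rs
  IsFactorization-resp w≈w' (ts , prod≈w) = ts , trans prod≈w w≈w'

  IsMinFactorization-resp : ∀ {w w' k} {rs : Vec Carrier k} →
    w ≈ w' → IsMinFactorization w rs → IsMinFactorization w' rs
  IsMinFactorization-resp w≈w' (f , minimal) =
    IsFactorization-resp w≈w' f , λ m qs fq → minimal m qs (IsFactorization-resp (sym w≈w') fq)

  IsFactorization-conjFact : ∀ {w k} {rs : Vec Carrier k} →
    IsFactorization w rs → IsFactorization (w ⁻¹) (conjFact rs)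
  IsFactorization-conjFact (ts , prod≈w) =
    conjFactAux-reflections ε ts , trans (prod-conjFact ts) (⁻¹-cong prod≈w)

  IsMinFactorization-conjFact : ∀ {w k} {rs : Vec Carrier k} →
    IsMinFactorization w rs → IsMinFactorization (w ⁻¹) (conjFact rs)
  IsMinFactorization-conjFact {w} (f , minimal) = IsFactorization-conjFact f , λ m qs fq →
    minimal m (conjFact qs) (IsFactorization-resp (⁻¹-involutive w) (IsFactorization-conjFact fq))

  eval-ʳ++ : ∀ xs ys → eval (xs ʳ++ ys) ≈ eval xs ⁻¹ ∙ eval ys
  eval-ʳ++ [] ys = sym (trans (∙-congʳ ε⁻¹≈ε) (identityˡ _))
  eval-ʳ++ (x ∷ xs) ys = begin
    eval (xs ʳ++ x ∷ ys)              ≈⟨ eval-ʳ++ xs (x ∷ ys) ⟩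
    eval xs ⁻¹ ∙ (gen x ∙ eval ys)    ≈⟨ sym (assoc _ _ _) ⟩
    (eval xs ⁻¹ ∙ gen x) ∙ eval ys    ≈⟨ ∙-congʳ (∙-congˡ (inverseʳ-unique _ _ (gen-involutive x))) ⟩
    (eval xs ⁻¹ ∙ gen x ⁻¹) ∙ eval ys ≈⟨ ∙-congʳ (sym (⁻¹-anti-homo-∙ (gen x) (eval xs))) ⟩
    (gen x ∙ eval xs) ⁻¹ ∙ eval ys    ∎

  eval-reverse : ∀ xs → eval (reverse xs) ≈ eval xs ⁻¹
  eval-reverse xs = trans (eval-ʳ++ xs []) (identityʳ _)

  IsLength-resp : ∀ {w w' a} → w ≈ w' → IsLength w a → IsLength w' a
  IsLength-resp w≈w' ((ws , len , ev) , minimal) =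
    (ws , len , trans ev w≈w') , λ vs ev' → minimal vs (trans ev' (sym w≈w'))

  IsLength-⁻¹ : ∀ {w a} → IsLength w a → IsLength (w ⁻¹) a
  IsLength-⁻¹ {w} ((ws , len , ev) , minimal) =
    (reverse ws , ≡.trans (length-reverse ws) len , trans (eval-reverse ws) (⁻¹-cong ev)) ,
    λ vs ev' → ≡.subst (_ ≤_) (length-reverse vs)
      (minimal (reverse vs) (trans (eval-reverse vs) (trans (⁻¹-cong ev') (⁻¹-involutive w))))

  IsLength-⁻¹-⇔ : ∀ {w w' a} → w' ≈ w ⁻¹ → IsLength w a ⇔ IsLength w' a
  IsLength-⁻¹-⇔ {w} w'≈w⁻¹ = mk⇔
    (λ ℓw → IsLength-resp (sym w'≈w⁻¹) (IsLength-⁻¹ ℓw))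
    (λ ℓw' → IsLength-resp (trans (⁻¹-cong w'≈w⁻¹) (⁻¹-involutive w)) (IsLength-⁻¹ ℓw'))

  OneWay-resp-lengths : ∀ {k} {xs ys : Vec Carrier k} →
    (∀ j a → IsLength (prefix xs j) a ⇔ IsLength (prefix ys j) a) →
    ∀ i → OneWay xs i ⇔ OneWay ys i
  OneWay-resp-lengths same i = mk⇔
    (λ (a , b , ℓa , ℓb , a<b) → a , b , to (same j a) ℓa , to (same (suc j) b) ℓb , a<b)
    (λ (a , b , ℓa , ℓb , a<b) → a , b , from (same j a) ℓa , from (same (suc j) b) ℓb , a<b)
    where
    open Equivalence
    j : ℕ
    j = toℕ i

  OneWay-conjFact : ∀ {k} {rs : Vec Carrier k} → AllV IsReflection rs →
    ∀ i → OneWay rs i ⇔ OneWay (conjFact rs) i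
  OneWay-conjFact ts = OneWay-resp-lengths λ j a → IsLength-⁻¹-⇔ (prefix-conjFact ts j)

mainTheorem4 : ∀ {c ℓ : Level} (G : Group c ℓ) (n : ℕ) (gen : Fin n → Group.Carrier G) →
    Coxeter.IsFiniteCoxeterSystem G gen →
    ∀ (cox : Group.Carrier G) → Coxeter.IsCoxeterElement G gen cox →
    (∀ {k} (rs : Vec (Group.Carrier G) k) → Coxeter.IsMinFactorization G gen cox rs →
       Coxeter.IsMinFactorization G gen (Group._⁻¹ G cox) (Coxeter.conjFact G gen rs)
       × (∀ (i : Fin k) → Coxeter.OneWay G gen rs i ⇔ Coxeter.OneWay G gen (Coxeter.conjFact G gen rs) i))
    × (∀ {k} (rs qs : Vec (Group.Carrier G) k) →
       Coxeter.IsMinFactorization G gen cox rs → Coxeter.IsMinFactorization G gen cox qs →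
       Coxeter._≋_ G gen (Coxeter.conjFact G gen rs) (Coxeter.conjFact G gen qs) →
       Coxeter._≋_ G gen rs qs)
    × (∀ {k} (qs : Vec (Group.Carrier G) k) →
       Coxeter.IsMinFactorization G gen (Group._⁻¹ G cox) qs →
       ∃[ rs ] (Coxeter.IsMinFactorization G gen cox rs
                × Coxeter._≋_ G gen (Coxeter.conjFact G gen rs) qs))
mainTheorem4 G _ gen (coxeterSystem , _) cox _ =
    (λ _ min → IsMinFactorization-conjFact min , OneWay-conjFact (reflections min))
  , (λ _ _ _ _ → conjFactAux-injective refl)
  , (λ qs min → conjFact qs
       , IsMinFactorization-resp (⁻¹-involutive cox) (IsMinFactorization-conjFact min)
       , conjFactAux-involutive ε ε (reflections min) (sym ε⁻¹≈ε))
  where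
  open Group G using (Carrier; ε; refl; sym)
  open GroupProperties G using (⁻¹-involutive; ε⁻¹≈ε)
  open Coxeter G gen using (conjFact; IsMinFactorization; AllV; IsReflection)
  open Factorizations G gen (Coxeter.IsCoxeterSystem.gen-involution coxeterSystem)

  reflections : ∀ {w k} {rs : Vec Carrier k} → IsMinFactorization w rs → AllV IsReflection rs
  reflections = proj₁ ∘ proj₁
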